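{- Let $R$ be a region with $n$ cells, $n$ a multiple of $3$, and let $P\subseteq R$ be a set of $|P| = n/3$ peg cells. Let $G$ be the region network of $(R,P)$. Then the value of a maximum flow in $G$ equals $|R|/3$ if and only if there is a p-cover of $(R,P)$.
   Context: A cell is a unit square $[x,x+1]\times[y,y+1]$, $x,y\in\mathbb Z$; it lies in row $y$. A region is a finite union of cells with connected interior; two cells are adjacent if their Manhattan distance is $1$. A tromino is an L-shaped set of three cells: a corner cell plus two tips adjacent to it, one horizontally and one vertically. A p-cover of $(R,P)$ is a set of pairwise non-overlapping trominoes contained in $R$ covering all cells of $R$, each with its corner cell in $P$ and its tips outside $P$. Region network: color a cell black if its row is even and white if odd; let $B$ be the black cells not in $P$ and $W$ the white cells not in $P$. $G$ has a vertex for each cell of $R$ plus a source $s$ and sink $t$; directed edges $s\to b$ for each $b\in B$; $w\to t$ for each $w\in W$; $b\to p$ for $b\in B$, $p\in P$ adjacent in $R$; $p\to w$ for $p\in P$, $w\in W$ adjacent in $R$. All edges have capacity $1$; every cell vertex has vertex capacity $1$, and $s,t$ have infinite capacity. A flow is a function $f:E(G)\to\mathbb N$ respecting edge capacities, with total flow entering each vertex at most its vertex capacity, and with flow conservation at every vertex other than $s,t$; its value is $|f|=\sum_v f(s,v)$. -}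

module Defs where

open import Data.Nat using (ℕ; _≤_)
open import Data.Nat.Divisibility using (_∣_)
open import Data.Integer as ℤ using (ℤ; ∣_∣; _-_; _+_; 1ℤ; -1ℤ)
open import Data.Product using (_×_; _,_; Σ; ∃)
open import Data.List using (List; []; _∷_; map)
open import Data.Nat.ListAction using (sum)
open import Data.List.Membership.Propositional using (_∈_; _∉_)
open import Data.List.Relation.Unary.Unique.Propositional using (Unique)
open import Data.List.Relation.Unary.AllPairs using (AllPairs)
open import Data.List.Relation.Binary.Disjoint.Propositional using (Disjoint)
open import Relation.Binary.PropositionalEquality using (_≡_)
open import Relation.Nullary using (¬_)

-- A cell [x,x+1]×[y,y+1] is identified with its lower-left corner (x , y); it lies in row y.
Cell : Set
Cell = ℤ × ℤ

row : Cell → ℤ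
row (_ , y) = y

Adjacent : Cell → Cell → Set
Adjacent (x₁ , y₁) (x₂ , y₂) = Data.Nat._+_ ∣ x₁ - x₂ ∣ ∣ y₁ - y₂ ∣ ≡ 1

data Path (R : List Cell) : Cell → Cell → Set where
  here : ∀ {a} → a ∈ R → Path R a a
  step : ∀ {a b c} → a ∈ R → Adjacent a b → Path R b c → Path R a c

-- A region: a finite set of cells (duplicate-free list) whose interior is connected,
-- i.e. any two cells are joined by a chain of adjacent cells in the region.
record IsRegion (R : List Cell) : Set where
  field
    distinct  : Unique R
    connected : ∀ {a b} → a ∈ R → b ∈ R → Path R a b

Black : Cell → Set
Black c = 2 ∣ ∣ row c ∣

White : Cell → Set
White c = ¬ Black c

-- Trominoes: corner cell plus a horizontal tip (x+dx , y) and a vertical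
-- tip (x , y+dy), with dx , dy ∈ {1 , -1}.

data Sign : Set where
  plus minus : Sign

toℤ : Sign → ℤ
toℤ plus  = 1ℤ
toℤ minus = -1ℤ

record Tromino : Set where
  constructor tromino
  field
    corner : Cell
    dx     : Sign
    dy     : Sign

htip : Tromino → Cell
htip (tromino (x , y) dx dy) = (x + toℤ dx , y)

vtip : Tromino → Cell
vtip (tromino (x , y) dx dy) = (x , y + toℤ dy)

cellsOf : Tromino → List Cell
cellsOf t = Tromino.corner t ∷ htip t ∷ vtip t ∷ []

record PCover (R P : List Cell) (T : List Tromino) : Set where
  field
    disjoint   : AllPairs (λ t u → Disjoint (cellsOf t) (cellsOf u)) T
    contained  : ∀ {t} → t ∈ T → ∀ {c} → c ∈ cellsOf t → c ∈ R
    cornerPeg  : ∀ {t} → t ∈ T → Tromino.corner t ∈ P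
    htipFree   : ∀ {t} → t ∈ T → htip t ∉ P
    vtipFree   : ∀ {t} → t ∈ T → vtip t ∉ P
    covers     : ∀ {c} → c ∈ R → ∃ λ t → t ∈ T × c ∈ cellsOf t

HasPCover : List Cell → List Cell → Set
HasPCover R P = ∃ λ T → PCover R P T

data Vertex : Set where
  src snk : Vertex
  cell    : Cell → Vertex

InB : List Cell → List Cell → Cell → Set
InB R P c = c ∈ R × c ∉ P × Black c

InW : List Cell → List Cell → Cell → Set
InW R P c = c ∈ R × c ∉ P × White c

data Edge (R P : List Cell) : Vertex → Vertex → Set where
  s→b : ∀ {b} → InB R P b → Edge R P src (cell b)
  w→t : ∀ {w} → InW R P w → Edge R P (cell w) snk
  b→p : ∀ {b p} → InB R P b → p ∈ P → Adjacent b p → Edge R P (cell b) (cell p)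
  p→w : ∀ {p w} → p ∈ P → InW R P w → Adjacent p w → Edge R P (cell p) (cell w)

vertices : List Cell → List Vertex
vertices R = src ∷ snk ∷ map cell R

inflow : List Cell → (Vertex → Vertex → ℕ) → Vertex → ℕ
inflow R f v = sum (map (λ u → f u v) (vertices R))

outflow : List Cell → (Vertex → Vertex → ℕ) → Vertex → ℕ
outflow R f v = sum (map (λ u → f v u) (vertices R))

-- A flow: f : E(G) → ℕ, represented as a function on all ordered vertex
-- pairs that vanishes off E(G).
record IsFlow (R P : List Cell) (f : Vertex → Vertex → ℕ) : Set where
  field
    offEdge      : ∀ u v → ¬ Edge R P u v → f u v ≡ 0
    edgeCap      : ∀ u v → f u v ≤ 1
    vertexCap    : ∀ {c} → c ∈ R → inflow R f (cell c) ≤ 1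
    conservation : ∀ {c} → c ∈ R → inflow R f (cell c) ≡ outflow R f (cell c)

value : List Cell → (Vertex → Vertex → ℕ) → ℕ
value R f = outflow R f src

IsMaxFlowValue : List Cell → List Cell → ℕ → Set
IsMaxFlowValue R P v =
  (∃ λ f → IsFlow R P f × value R f ≡ v) ×
  (∀ f → IsFlow R P f → value R f ≤ v)

module Submission where

-- Flow leaves the source only into black
-- non-peg cells, and such a cell can pass it on only to pegs; as every peg has
-- vertex capacity 1, no flow has value more than |P| = |R|/3.
-- Flow ⇒ cover (FromSaturatedFlow).  In a flow of value |P| each peg p receives
-- a unit from a black neighbour b and passes it to a white neighbour w, and
-- {p , b , w} is a tromino with corner p (tromino-at).  Capacities make the
-- trominoes of distinct pegs disjoint, and |R|/3 disjoint trominoes in R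
-- cover R by counting cells (Packing).  Each tromino gives a path src → black tip →
-- corner → white tip → snk; the sum of these paths conserves flow path by path,
-- respects vertex capacities because the trominoes are disjoint, and has value
-- |T| = |R|/3.

open import Defs
open import Algebra.Properties.CommutativeSemigroup using (interchange)
open import Data.Nat as ℕ using (ℕ; zero; suc; _+_; _*_; _≤_; _/_; z≤n; s≤s)
open import Data.Nat.Properties
  using (≤-refl; ≤-trans; ≤-reflexive; ≤-antisym; +-mono-≤; +-monoʳ-≤; *-monoʳ-≤;
         +-comm; +-assoc; +-identityʳ; *-comm; *-identityˡ; *-identityʳ; *-zeroʳ; *-suc;
         *-distribʳ-+; *-distribˡ-+; m≤m+n; m≤n+m; m≤n⇒m<n∨m≡n; <⇒≱; +-mono-<-≤; +-mono-≤-<;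
         n≤0⇒n≡0; ≮⇒≥; +-commutativeSemigroup; module ≤-Reasoning)
open import Data.Nat.Divisibility using (_∣_; _∣?_; divides; ∣m+n∣m⇒∣n; ∣⇒≤)
open import Data.Nat.DivMod using (m*[n/m]≡n; m*n/n≡m)
open import Data.Nat.ListAction using (sum)
import Data.Integer as ℤ
import Data.Integer.Properties as ℤ
open import Data.Integer.Tactic.RingSolver using (solve-∀)
open import Data.List using (List; []; _∷_; map; length)
open import Data.List.Properties using (map-∘)
open import Data.List.Membership.Propositional using (_∈_; _∉_)
open import Data.List.Membership.Propositional.Properties using (∈-map⁺)
open import Data.List.Relation.Unary.Any using (here; there)
open import Data.List.Relation.Unary.All as All using (All; []; _∷_)
open import Data.List.Relation.Unary.All.Properties using (All¬⇒¬Any)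
open import Data.List.Relation.Unary.AllPairs as AllPairs using (AllPairs; []; _∷_)
open import Data.List.Relation.Unary.Unique.Propositional using (Unique)
open import Data.List.Relation.Binary.Subset.Propositional using (_⊆_)
open import Data.List.Relation.Binary.Disjoint.Propositional using (Disjoint)
open import Data.Product using (_×_; _,_; Σ; ∃; proj₁; proj₂)
open import Data.Product.Properties using (≡-dec)
open import Data.Sum using (_⊎_; inj₁; inj₂)
open import Data.Empty using (⊥; ⊥-elim)
open import Function using (_∘_)
open import Function.Bundles using (_⇔_; mk⇔)
open import Relation.Nullary using (¬_; Dec; yes; no; contradiction)
open import Relation.Nullary.Decidable using (map′; _×-dec_; _⊎-dec_; ¬?)
open import Relation.Binary.Definitions using (DecidableEquality)
open import Relation.Binary.PropositionalEquality
  using (_≡_; _≢_; refl; sym; trans; cong; cong₂; subst; module ≡-Reasoning)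

∑ : {A : Set} → List A → (A → ℕ) → ℕ
∑ L g = sum (map g L)

module _ {A : Set} where

  ∑-cong : ∀ {g h : A → ℕ} L → (∀ {x} → x ∈ L → g x ≡ h x) → ∑ L g ≡ ∑ L h
  ∑-cong []      _   = refl
  ∑-cong (x ∷ L) g≡h = cong₂ _+_ (g≡h (here refl)) (∑-cong L (g≡h ∘ there))

  ∑-mono : ∀ {g h : A → ℕ} L → (∀ {x} → x ∈ L → g x ≤ h x) → ∑ L g ≤ ∑ L h
  ∑-mono []      _   = z≤n
  ∑-mono (x ∷ L) g≤h = +-mono-≤ (g≤h (here refl)) (∑-mono L (g≤h ∘ there))

  ∑-zero : ∀ {g : A → ℕ} L → (∀ {x} → x ∈ L → g x ≡ 0) → ∑ L g ≡ 0
  ∑-zero []      _  = refl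
  ∑-zero (x ∷ L) g0 = cong₂ _+_ (g0 (here refl)) (∑-zero L (g0 ∘ there))

  ∑-const : ∀ k (L : List A) → ∑ L (λ _ → k) ≡ k * length L
  ∑-const k []      = sym (*-zeroʳ k)
  ∑-const k (x ∷ L) = trans (cong (k +_) (∑-const k L)) (sym (*-suc k (length L)))

  ∑-length : ∀ (L : List A) → ∑ L (λ _ → 1) ≡ length L
  ∑-length L = trans (∑-const 1 L) (*-identityˡ (length L))

  ∑-+ : ∀ (g h : A → ℕ) L → ∑ L (λ x → g x + h x) ≡ ∑ L g + ∑ L h
  ∑-+ g h []      = refl
  ∑-+ g h (x ∷ L) = trans (cong (g x + h x +_) (∑-+ g h L)) (interchange +-commutativeSemigroup (g x) (h x) (∑ L g) (∑ L h))

  ∑-*ˡ : ∀ k (g : A → ℕ) L → ∑ L (λ x → k * g x) ≡ k * ∑ L g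
  ∑-*ˡ k g []      = sym (*-zeroʳ k)
  ∑-*ˡ k g (x ∷ L) = trans (cong (k * g x +_) (∑-*ˡ k g L)) (sym (*-distribˡ-+ k (g x) (∑ L g)))

  ∑-*ʳ : ∀ k (g : A → ℕ) L → ∑ L (λ x → g x * k) ≡ ∑ L g * k
  ∑-*ʳ k g []      = refl
  ∑-*ʳ k g (x ∷ L) = trans (cong (g x * k +_) (∑-*ʳ k g L)) (sym (*-distribʳ-+ k (g x) (∑ L g)))

  ∑-member : ∀ (g : A → ℕ) {L x} → x ∈ L → g x ≤ ∑ L g
  ∑-member g {y ∷ L} (here refl) = m≤m+n (g y) (∑ L g)
  ∑-member g {y ∷ L} (there x∈L) = ≤-trans (∑-member g x∈L) (m≤n+m (∑ L g) (g y))

  ∑-pair : ∀ (g : A → ℕ) {L x y} → x ∈ L → y ∈ L → x ≢ y → g x + g y ≤ ∑ L g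
  ∑-pair g (here refl) (here refl)   x≢y = ⊥-elim (x≢y refl)
  ∑-pair g (here refl) (there y∈L)   _   = +-monoʳ-≤ (g _) (∑-member g y∈L)
  ∑-pair g {z ∷ L} {x} (there x∈L) (here refl) _ =
    ≤-trans (≤-reflexive (+-comm (g x) (g z))) (+-monoʳ-≤ (g z) (∑-member g x∈L))
  ∑-pair g {z ∷ L} (there x∈L) (there y∈L) x≢y = ≤-trans (∑-pair g x∈L y∈L x≢y) (m≤n+m (∑ L g) (g z))

  ∑-pos : ∀ (g : A → ℕ) L → 1 ≤ ∑ L g → ∃ λ x → x ∈ L × 1 ≤ g x
  ∑-pos g (x ∷ L) pos with g x in gx
  ... | suc _ = x , here refl , subst (1 ≤_) (sym gx) (s≤s z≤n)
  ... | zero with ∑-pos g L pos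
  ...   | y , y∈L , gy = y , there y∈L , gy

  ∑-tight : ∀ (g h : A → ℕ) L → (∀ {x} → x ∈ L → g x ≤ h x) → ∑ L h ≤ ∑ L g → ∀ {x} → x ∈ L → h x ≤ g x
  ∑-tight g h (y ∷ L) g≤h sum≤ (here refl) with m≤n⇒m<n∨m≡n (g≤h (here refl))
  ... | inj₂ gy≡hy = ≤-reflexive (sym gy≡hy)
  ... | inj₁ gy<hy = ⊥-elim (<⇒≱ (+-mono-<-≤ gy<hy (∑-mono L (g≤h ∘ there))) sum≤)
  ∑-tight g h (y ∷ L) g≤h sum≤ (there x∈L) with m≤n⇒m<n∨m≡n (∑-mono L (g≤h ∘ there))
  ... | inj₂ ∑g≡∑h = ∑-tight g h L (g≤h ∘ there) (≤-reflexive (sym ∑g≡∑h)) x∈L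
  ... | inj₁ ∑g<∑h = ⊥-elim (<⇒≱ (+-mono-≤-< (g≤h (here refl)) ∑g<∑h) sum≤)

  ∑-atMostOne : ∀ (g : A → ℕ) L → AllPairs (λ x y → 1 ≤ g x → 1 ≤ g y → ⊥) L
              → (∀ {x} → x ∈ L → g x ≤ 1) → ∑ L g ≤ 1
  ∑-atMostOne g []      _        _   = z≤n
  ∑-atMostOne g (x ∷ L) (x⊥ ∷ ⊥s) g≤1 with g x in gx
  ... | zero  = ∑-atMostOne g L ⊥s (g≤1 ∘ there)
  ... | suc k = subst (λ s → suc k + s ≤ 1) (sym rest≡0) (≤-trans (≤-reflexive (+-identityʳ (suc k))) gx≤1)
    where
    gx≤1 : suc k ≤ 1
    gx≤1 = subst (_≤ 1) gx (g≤1 (here refl))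
    rest≡0 : ∑ L g ≡ 0
    rest≡0 = ∑-zero L (λ y∈L → n≤0⇒n≡0 (≮⇒≥ (All.lookup x⊥ y∈L (s≤s z≤n))))

∑-swap : ∀ {A B : Set} (k : A → B → ℕ) (L₁ : List A) (L₂ : List B)
       → ∑ L₁ (λ a → ∑ L₂ (k a)) ≡ ∑ L₂ (λ b → ∑ L₁ (λ a → k a b))
∑-swap k []       L₂ = sym (∑-const 0 L₂)
∑-swap k (a ∷ L₁) L₂ = trans (cong (∑ L₂ (k a) +_) (∑-swap k L₁ L₂)) (sym (∑-+ (k a) (λ b → ∑ L₁ (λ a′ → k a′ b)) L₂))

𝟙 : {X : Set} → Dec X → ℕ
𝟙 (yes _) = 1
𝟙 (no _)  = 0

module _ {X : Set} where

  𝟙-yes : (d : Dec X) → X → 𝟙 d ≡ 1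
  𝟙-yes (yes _) _ = refl
  𝟙-yes (no ¬x) x = ⊥-elim (¬x x)

  𝟙-no : (d : Dec X) → ¬ X → 𝟙 d ≡ 0
  𝟙-no (yes x) ¬x = ⊥-elim (¬x x)
  𝟙-no (no _)  _  = refl

  𝟙≤1 : (d : Dec X) → 𝟙 d ≤ 1
  𝟙≤1 (yes _) = ≤-refl
  𝟙≤1 (no _)  = z≤n

  𝟙-pos : (d : Dec X) → 1 ≤ 𝟙 d → X
  𝟙-pos (yes x) _ = x

  𝟙-cong : {Y : Set} (d : Dec X) (e : Dec Y) → (X → Y) → (Y → X) → 𝟙 d ≡ 𝟙 e
  𝟙-cong (yes _) (yes _) _   _   = refl
  𝟙-cong (yes x) (no ¬y) x→y _   = ⊥-elim (¬y (x→y x))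
  𝟙-cong (no ¬x) (yes y) _   y→x = ⊥-elim (¬x (y→x y))
  𝟙-cong (no _)  (no _)  _   _   = refl

module Counting {A : Set} (_≟_ : DecidableEquality A) where

  open import Data.List.Membership.DecPropositional _≟_ public using (_∈?_)

  ∑-𝟙-≟ : ∀ {R} → Unique R → ∀ {x} → x ∈ R → ∑ R (λ d → 𝟙 (d ≟ x)) ≡ 1
  ∑-𝟙-≟ {y ∷ R} (y∉R ∷ _) {x} (here refl) = cong₂ _+_ (𝟙-yes (x ≟ x) refl) absent
    where
    absent : ∑ R (λ d → 𝟙 (d ≟ x)) ≡ 0
    absent = ∑-zero R (λ d∈R → 𝟙-no (_ ≟ x) (λ d≡x → All.lookup y∉R d∈R (sym d≡x)))
  ∑-𝟙-≟ {y ∷ R} (y∉R ∷ uR) (there x∈R) =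
    cong₂ _+_ (𝟙-no (y ≟ _) (All.lookup y∉R x∈R)) (∑-𝟙-≟ uR x∈R)

  𝟙-∈ : ∀ c {L} → Unique L → 𝟙 (c ∈? L) ≡ ∑ L (λ x → 𝟙 (c ≟ x))
  𝟙-∈ c {[]}    []          = refl
  𝟙-∈ c {x ∷ L} (x∉L ∷ uL) = trans (split (c ≟ x)) (cong (𝟙 (c ≟ x) +_) (𝟙-∈ c uL))
    where
    split : (d : Dec (c ≡ x)) → 𝟙 (c ∈? x ∷ L) ≡ 𝟙 d + 𝟙 (c ∈? L)
    split (yes c≡x) = trans (𝟙-yes (c ∈? x ∷ L) (here c≡x))
      (cong suc (sym (𝟙-no (c ∈? L) (λ c∈L → All¬⇒¬Any x∉L (subst (_∈ L) c≡x c∈L)))))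
    split (no c≢x)  = 𝟙-cong (c ∈? x ∷ L) (c ∈? L) drop there
      where
      drop : c ∈ x ∷ L → c ∈ L
      drop (here c≡x)  = ⊥-elim (c≢x c≡x)
      drop (there c∈L) = c∈L

  ∑-𝟙-∈ : ∀ {R L} → Unique R → Unique L → L ⊆ R → ∑ R (λ c → 𝟙 (c ∈? L)) ≡ length L
  ∑-𝟙-∈ {R} {L} uR uL L⊆R = begin
    ∑ R (λ c → 𝟙 (c ∈? L))                 ≡⟨ ∑-cong R (λ {c} _ → 𝟙-∈ c uL) ⟩
    ∑ R (λ c → ∑ L (λ x → 𝟙 (c ≟ x)))      ≡⟨ ∑-swap (λ c x → 𝟙 (c ≟ x)) R L ⟩
    ∑ L (λ x → ∑ R (λ c → 𝟙 (c ≟ x)))      ≡⟨ ∑-cong L (λ x∈L → ∑-𝟙-≟ uR (L⊆R x∈L)) ⟩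
    ∑ L (λ _ → 1)                          ≡⟨ ∑-length L ⟩
    length L                               ∎
    where open ≡-Reasoning

choose : {A B : Set} {Q : A → B → Set} {_~_ : B → B → Set} (xs : List A) → Unique xs
       → (∀ {x} → x ∈ xs → Σ B (Q x))
       → (∀ {x y b c} → x ≢ y → Q x b → Q y c → b ~ c)
       → Σ (List B) λ ys → length ys ≡ length xs
                         × (∀ {y} → y ∈ ys → ∃ λ x → x ∈ xs × Q x y)
                         × AllPairs _~_ ys
choose []       _          _    _       = [] , refl , (λ ()) , []
choose {Q = Q} {_~_} (x ∷ xs) (x∉xs ∷ uxs) pick related
  with pick (here refl) | choose xs uxs (pick ∘ there) related
... | b , Qxb | ys , len , witness , pairs = b ∷ ys , cong suc len , witness′ , All.tabulate b~ys ∷ pairs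
  where
  witness′ : ∀ {y} → y ∈ b ∷ ys → ∃ λ x′ → x′ ∈ x ∷ xs × Q x′ y
  witness′ (here refl) = x , here refl , Qxb
  witness′ (there y∈ys) with witness y∈ys
  ... | x′ , x′∈xs , Qx′y = x′ , there x′∈xs , Qx′y
  b~ys : ∀ {y} → y ∈ ys → b ~ y
  b~ys y∈ys with witness y∈ys
  ... | x′ , x′∈xs , Qx′y = related (All.lookup x∉xs x′∈xs) Qxb Qx′y

_≟ᶜ_ : DecidableEquality Cell
_≟ᶜ_ = ≡-dec ℤ._≟_ ℤ._≟_

open Counting _≟ᶜ_

Black? : (c : Cell) → Dec (Black c)
Black? c = 2 ∣? ℤ.∣ row c ∣

OppositeParity : ℕ → ℕ → Set
OppositeParity a b = (2 ∣ a → ¬ 2 ∣ b) × (¬ 2 ∣ a → 2 ∣ b)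

opposite-sym : ∀ {a b} → OppositeParity a b → OppositeParity b a
opposite-sym {a} {b} (even⇒odd , odd⇒even) = (λ 2∣b 2∣a → even⇒odd 2∣a 2∣b) , odd⇒even′
  where
  odd⇒even′ : ¬ 2 ∣ b → 2 ∣ a
  odd⇒even′ ¬2∣b with 2 ∣? a
  ... | yes 2∣a = 2∣a
  ... | no ¬2∣a = ⊥-elim (¬2∣b (odd⇒even ¬2∣a))

even-or-next : ∀ n → 2 ∣ n ⊎ 2 ∣ suc n
even-or-next zero    = inj₁ (divides 0 refl)
even-or-next (suc n) with even-or-next n
... | inj₁ (divides q n≡q*2) = inj₂ (divides (suc q) (cong (λ m → suc (suc m)) n≡q*2))
... | inj₂ 2∣1+n             = inj₁ 2∣1+n

opposite-suc : ∀ n → OppositeParity n (suc n)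
opposite-suc n = not-both , one-of
  where
  not-both : 2 ∣ n → ¬ 2 ∣ suc n
  not-both 2∣n 2∣1+n with ∣⇒≤ (∣m+n∣m⇒∣n (subst (2 ∣_) (+-comm 1 n) 2∣1+n) 2∣n)
  ... | s≤s ()
  one-of : ¬ 2 ∣ n → 2 ∣ suc n
  one-of ¬2∣n with even-or-next n
  ... | inj₁ 2∣n   = ⊥-elim (¬2∣n 2∣n)
  ... | inj₂ 2∣1+n = 2∣1+n

rows-alternate : ∀ y s → OppositeParity ℤ.∣ y ∣ ℤ.∣ y ℤ.+ toℤ s ∣
rows-alternate y plus  = next-row y
  where
  next-row : ∀ y → OppositeParity ℤ.∣ y ∣ ℤ.∣ y ℤ.+ ℤ.1ℤ ∣
  next-row (ℤ.+ n)        = subst (OppositeParity n) (+-comm 1 n) (opposite-suc n)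
  next-row ℤ.-[1+ zero ]  = opposite-sym (opposite-suc 0)
  next-row ℤ.-[1+ suc n ] = opposite-sym (opposite-suc (suc n))
rows-alternate y minus = subst (λ z → OppositeParity ℤ.∣ z ∣ ℤ.∣ y ℤ.+ ℤ.-1ℤ ∣) y-1+1≡y
                               (opposite-sym (rows-alternate (y ℤ.+ ℤ.-1ℤ) plus))
  where
  y-1+1≡y : y ℤ.+ ℤ.-1ℤ ℤ.+ ℤ.1ℤ ≡ y
  y-1+1≡y = trans (ℤ.+-assoc y ℤ.-1ℤ ℤ.1ℤ) (ℤ.+-identityʳ y)

adjacent-sym : ∀ {a b} → Adjacent a b → Adjacent b a
adjacent-sym {x₁ , y₁} {x₂ , y₂} = subst (_≡ 1) (cong₂ _+_ (ℤ.∣i-j∣≡∣j-i∣ x₁ x₂) (ℤ.∣i-j∣≡∣j-i∣ y₁ y₂))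

private
  a-[a-b]≡b : ∀ a b → a ℤ.- (a ℤ.- b) ≡ b
  a-[a-b]≡b = solve-∀

  a-[a+t]≡-t : ∀ a t → a ℤ.- (a ℤ.+ t) ≡ ℤ.- t
  a-[a+t]≡-t = solve-∀

same-coordinate : ∀ a b → ℤ.∣ a ℤ.- b ∣ ≡ 0 → b ≡ a
same-coordinate a b d≡0 = sym (ℤ.i-j≡0⇒i≡j a b (ℤ.∣i∣≡0⇒i≡0 d≡0))

unit-difference : ∀ a b → ℤ.∣ a ℤ.- b ∣ ≡ 1 → ∃ λ s → b ≡ a ℤ.+ toℤ s
unit-difference a b d≡1 with a ℤ.- b in a-b | d≡1
... | ℤ.+[1+ 0 ] | _ = minus , trans (sym (a-[a-b]≡b a b)) (cong (λ d → a ℤ.- d) a-b)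
... | ℤ.-[1+ 0 ] | _ = plus  , trans (sym (a-[a-b]≡b a b)) (cong (λ d → a ℤ.- d) a-b)
... | ℤ.+ 0          | ()
... | ℤ.+[1+ suc _ ] | ()
... | ℤ.-[1+ suc _ ] | ()

neighbour : ∀ {x y c} → Adjacent (x , y) c
          → (∃ λ s → c ≡ (x ℤ.+ toℤ s , y)) ⊎ (∃ λ s → c ≡ (x , y ℤ.+ toℤ s))
neighbour {x} {y} {x′ , y′} adj with ℤ.∣ x ℤ.- x′ ∣ in dx | ℤ.∣ y ℤ.- y′ ∣ in dy | adj
... | 1 | 0 | _ with unit-difference x x′ dx
...   | s , x′≡x+s = inj₁ (s , cong₂ _,_ x′≡x+s (same-coordinate y y′ dy))
neighbour {x} {y} {x′ , y′} adj | 0 | 1 | _ with unit-difference y y′ dy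
...   | s , y′≡y+s = inj₂ (s , cong₂ _,_ (same-coordinate x x′ dx) y′≡y+s)
neighbour adj | 0           | 0           | ()
neighbour adj | 0           | suc (suc _) | ()
neighbour adj | 1           | suc _       | ()
neighbour adj | suc (suc _) | _           | ()

unit-step : ∀ a s → ℤ.∣ a ℤ.- (a ℤ.+ toℤ s) ∣ ≡ 1
unit-step a s = trans (cong ℤ.∣_∣ (a-[a+t]≡-t a (toℤ s))) (|-s| s)
  where
  |-s| : ∀ s → ℤ.∣ ℤ.- toℤ s ∣ ≡ 1
  |-s| plus  = refl
  |-s| minus = refl

htip-adjacent : ∀ t → Adjacent (Tromino.corner t) (htip t)
htip-adjacent (tromino (x , y) dx dy) = cong₂ _+_ (unit-step x dx) (cong ℤ.∣_∣ (ℤ.+-inverseʳ y))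

vtip-adjacent : ∀ t → Adjacent (Tromino.corner t) (vtip t)
vtip-adjacent (tromino (x , y) dx dy) = cong₂ _+_ (cong ℤ.∣_∣ (ℤ.+-inverseʳ x)) (unit-step y dy)

Tips : Tromino → Cell → Cell → Set
Tips t b w = (htip t ≡ b × vtip t ≡ w) ⊎ (htip t ≡ w × vtip t ≡ b)

tips⁺ : ∀ {t b w} → Tips t b w → {X : Cell → Set} → X (htip t) → X (vtip t) → X b × X w
tips⁺ (inj₁ (refl , refl)) xh xv = xh , xv
tips⁺ (inj₂ (refl , refl)) xh xv = xv , xh

tips⁻ : ∀ {t b w} → Tips t b w → {X : Cell → Set} → X b → X w → X (htip t) × X (vtip t)
tips⁻ (inj₁ (refl , refl)) xb xw = xb , xw
tips⁻ (inj₂ (refl , refl)) xb xw = xw , xb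

tips-sum : ∀ {t b w} → Tips t b w → (g : Cell → ℕ) → g b + g w ≡ g (htip t) + g (vtip t)
tips-sum (inj₁ (refl , refl)) g = refl
tips-sum {t} (inj₂ (refl , refl)) g = +-comm (g (vtip t)) (g (htip t))

tips-adjacent : ∀ {t b w} → Tips t b w → Adjacent b (Tromino.corner t) × Adjacent (Tromino.corner t) w
tips-adjacent {t} {b} tips with tips⁺ tips {Adjacent (Tromino.corner t)} (htip-adjacent t) (vtip-adjacent t)
... | adj-b , adj-w = adjacent-sym {Tromino.corner t} {b} adj-b , adj-w

cell-of-tromino : ∀ {t b w c} → Tips t b w → c ∈ cellsOf t → c ≡ Tromino.corner t ⊎ c ≡ b ⊎ c ≡ w
cell-of-tromino _                    (here c≡p)                = inj₁ c≡p
cell-of-tromino (inj₁ (refl , refl)) (there (here c≡b))        = inj₂ (inj₁ c≡b)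
cell-of-tromino (inj₁ (refl , refl)) (there (there (here c≡w))) = inj₂ (inj₂ c≡w)
cell-of-tromino (inj₂ (refl , refl)) (there (here c≡w))        = inj₂ (inj₂ c≡w)
cell-of-tromino (inj₂ (refl , refl)) (there (there (here c≡b))) = inj₂ (inj₁ c≡b)

record ColouredTips (t : Tromino) : Set where
  constructor colouredTips
  field
    blackTip       : Cell
    whiteTip       : Cell
    blackTip-black : Black blackTip
    whiteTip-white : White whiteTip
    tips-coloured  : Tips t blackTip whiteTip

-- Every tromino has one black and one white tip: the horizontal tip shares
-- the colour of the corner, the vertical tip has the other colour.
tipsByColour : (t : Tromino) → ColouredTips t
tipsByColour (tromino (x , y) dx dy) with Black? (x , y)
... | yes black = colouredTips _ _ black (proj₁ (rows-alternate y dy) black) (inj₁ (refl , refl))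
... | no  white = colouredTips _ _ (proj₂ (rows-alternate y dy) white) white (inj₂ (refl , refl))

open module TipsByColour (t : Tromino) = ColouredTips (tipsByColour t)

-- The two tips of a tromino are distinct, having different colours.
htip≢vtip : ∀ t → htip t ≢ vtip t
htip≢vtip t h≡v with tipsByColour t
... | colouredTips _ _ black white (inj₁ (refl , refl)) = white (subst Black h≡v black)
... | colouredTips _ _ black white (inj₂ (refl , refl)) = white (subst Black (sym h≡v) black)

tromino-distinct : ∀ {P t} → Tromino.corner t ∈ P → htip t ∉ P → vtip t ∉ P → Unique (cellsOf t)
tromino-distinct {P} {t} p∈P h∉P v∉P =
  ((λ p≡h → h∉P (subst (_∈ P) p≡h p∈P)) ∷ (λ p≡v → v∉P (subst (_∈ P) p≡v p∈P)) ∷ [])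
  ∷ (htip≢vtip t ∷ []) ∷ [] ∷ []

-- A cell p with a black neighbour b and a white neighbour w is the corner of
-- a tromino with tips b and w: the neighbour of p's colour lies in p's row.
tromino-at : ∀ {p b w} → Black b → White w → Adjacent p b → Adjacent p w
           → Σ Tromino λ t → Tromino.corner t ≡ p × Tips t b w
tromino-at {x , y} {b} {w} black white adj-b adj-w
  with Black? (x , y) | neighbour {x} {y} {b} adj-b | neighbour {x} {y} {w} adj-w
... | yes p-black | inj₂ (s , refl) | _                = ⊥-elim (proj₁ (rows-alternate y s) p-black black)
... | yes p-black | _               | inj₁ (s , refl)  = ⊥-elim (white p-black)
... | yes _       | inj₁ (s , refl) | inj₂ (s′ , refl) = tromino (x , y) s s′ , refl , inj₁ (refl , refl)
... | no  p-white | inj₁ (s , refl) | _                = ⊥-elim (p-white black)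
... | no  p-white | _               | inj₂ (s , refl)  = ⊥-elim (white (proj₂ (rows-alternate y s) p-white))
... | no  _       | inj₂ (s , refl) | inj₁ (s′ , refl) = tromino (x , y) s′ s , refl , inj₂ (refl , refl)

Apart : Tromino → Tromino → Set
Apart t u = Disjoint (cellsOf t) (cellsOf u)

occupies : Tromino → Cell → ℕ
occupies t c = 𝟙 (c ∈? cellsOf t)

module Packing {R : List Cell} (uR : Unique R) {T : List Tromino}
  (disjoint : AllPairs Apart T)
  (distinct : ∀ {t} → t ∈ T → Unique (cellsOf t))
  (inside   : ∀ {t} → t ∈ T → ∀ {c} → c ∈ cellsOf t → c ∈ R) where

  Covered : Cell → Set
  Covered c = ∃ λ t → t ∈ T × c ∈ cellsOf t

  occupancy≤1 : ∀ c → ∑ T (λ t → occupies t c) ≤ 1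
  occupancy≤1 c = ∑-atMostOne (λ t → occupies t c) T
    (AllPairs.map (λ {t} {u} t∩u≡∅ occ-t occ-u → t∩u≡∅ (𝟙-pos (c ∈? cellsOf t) occ-t , 𝟙-pos (c ∈? cellsOf u) occ-u)) disjoint)
    (λ {t} _ → 𝟙≤1 (c ∈? cellsOf t))

  total-occupancy : ∑ R (λ c → ∑ T (λ t → occupies t c)) ≡ 3 * length T
  total-occupancy = begin
    ∑ R (λ c → ∑ T (λ t → occupies t c)) ≡⟨ ∑-swap (λ c t → occupies t c) R T ⟩
    ∑ T (λ t → ∑ R (occupies t))         ≡⟨ ∑-cong T (λ t∈T → ∑-𝟙-∈ uR (distinct t∈T) (inside t∈T)) ⟩
    ∑ T (λ _ → 3)                        ≡⟨ ∑-const 3 T ⟩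
    3 * length T                         ∎
    where open ≡-Reasoning

  covers : length R ≤ 3 * length T → ∀ {c} → c ∈ R → Covered c
  covers |R|≤3|T| {c} c∈R =
    let (t , t∈T , occ) = ∑-pos (λ t → occupies t c) T occupied in t , t∈T , 𝟙-pos (c ∈? cellsOf t) occ
    where
    enough : ∑ R (λ _ → 1) ≤ ∑ R (λ c → ∑ T (λ t → occupies t c))
    enough = ≤-trans (≤-reflexive (∑-length R)) (≤-trans |R|≤3|T| (≤-reflexive (sym total-occupancy)))
    occupied : 1 ≤ ∑ T (λ t → occupies t c)
    occupied = ∑-tight (λ c → ∑ T (λ t → occupies t c)) (λ _ → 1) R (λ {c} _ → occupancy≤1 c) enough c∈R

  size : (∀ {c} → c ∈ R → Covered c) → length R ≡ 3 * length T
  size cover = begin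
    length R                             ≡⟨ sym (∑-length R) ⟩
    ∑ R (λ _ → 1)                        ≡⟨ ∑-cong R (λ c∈R → sym (once c∈R)) ⟩
    ∑ R (λ c → ∑ T (λ t → occupies t c)) ≡⟨ total-occupancy ⟩
    3 * length T                         ∎
    where
    open ≡-Reasoning
    once : ∀ {c} → c ∈ R → ∑ T (λ t → occupies t c) ≡ 1
    once {c} c∈R with cover c∈R
    ... | t , t∈T , c∈t = ≤-antisym (occupancy≤1 c)
      (≤-trans (≤-reflexive (sym (𝟙-yes (c ∈? cellsOf t) c∈t))) (∑-member (λ t → occupies t c) t∈T))

module Network (R P : List Cell) where

  adjacent? : ∀ a b → Dec (Adjacent a b)
  adjacent? (x₁ , y₁) (x₂ , y₂) = _ ℕ.≟ 1

  inB? : ∀ c → Dec (InB R P c)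
  inB? c = c ∈? R ×-dec ¬? (c ∈? P) ×-dec Black? c

  inW? : ∀ c → Dec (InW R P c)
  inW? c = c ∈? R ×-dec ¬? (c ∈? P) ×-dec ¬? (Black? c)

  edge? : ∀ u v → Dec (Edge R P u v)
  edge? src      (cell b) = map′ s→b (λ { (s→b b∈B) → b∈B }) (inB? b)
  edge? (cell w) snk      = map′ w→t (λ { (w→t w∈W) → w∈W }) (inW? w)
  edge? (cell a) (cell b) = map′ from to
    ((inB? a ×-dec b ∈? P ×-dec adjacent? a b) ⊎-dec (a ∈? P ×-dec inW? b ×-dec adjacent? a b))
    where
    from : (InB R P a × b ∈ P × Adjacent a b) ⊎ (a ∈ P × InW R P b × Adjacent a b) → Edge R P (cell a) (cell b)
    from (inj₁ (a∈B , b∈P , adj)) = b→p a∈B b∈P adj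
    from (inj₂ (a∈P , b∈W , adj)) = p→w a∈P b∈W adj
    to : Edge R P (cell a) (cell b) → (InB R P a × b ∈ P × Adjacent a b) ⊎ (a ∈ P × InW R P b × Adjacent a b)
    to (b→p a∈B b∈P adj) = inj₁ (a∈B , b∈P , adj)
    to (p→w a∈P b∈W adj) = inj₂ (a∈P , b∈W , adj)
  edge? src      src      = no λ ()
  edge? src      snk      = no λ ()
  edge? snk      _        = no λ ()
  edge? (cell _) src      = no λ ()

  ∑-vertices : ∀ (g : Vertex → ℕ) → ∑ (vertices R) g ≡ g src + (g snk + ∑ R (g ∘ cell))
  ∑-vertices g = cong (λ xs → g src + (g snk + sum xs)) (sym (map-∘ R))

  cell∈vertices : ∀ {c} → c ∈ R → cell c ∈ vertices R
  cell∈vertices c∈R = there (there (∈-map⁺ cell c∈R))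

  -- Vertex capacities and conservation already force the edge capacities:
  -- every edge of G enters or leaves a cell of R.
  edge-capacity : ∀ {f} → P ⊆ R → (∀ u v → ¬ Edge R P u v → f u v ≡ 0)
                → (∀ {c} → c ∈ R → inflow R f (cell c) ≤ 1)
                → (∀ {c} → c ∈ R → inflow R f (cell c) ≡ outflow R f (cell c))
                → ∀ u v → f u v ≤ 1
  edge-capacity {f} P⊆R offEdge vertexCap conservation u v with edge? u v
  ... | no ¬e = subst (_≤ 1) (sym (offEdge u v ¬e)) z≤n
  ... | yes (s→b {b} (b∈R , _)) =
    ≤-trans (∑-member (λ u → f u (cell b)) {vertices R} (here refl)) (vertexCap b∈R)
  ... | yes (b→p {b} {p} (b∈R , _) p∈P _) =
    ≤-trans (∑-member (λ u → f u (cell p)) {vertices R} (cell∈vertices b∈R)) (vertexCap (P⊆R p∈P))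
  ... | yes (p→w {p} {w} p∈P (w∈R , _) _) =
    ≤-trans (∑-member (λ u → f u (cell w)) {vertices R} (cell∈vertices (P⊆R p∈P))) (vertexCap w∈R)
  ... | yes (w→t {w} (w∈R , _)) =
    ≤-trans (∑-member (f (cell w)) {vertices R} (there (here refl)))
            (≤-trans (≤-reflexive (sym (conservation w∈R))) (vertexCap w∈R))

  module Flow {f} (F : IsFlow R P f) where
    open IsFlow F

    positive-edge : ∀ {u v} → 1 ≤ f u v → Edge R P u v
    positive-edge {u} {v} pos with edge? u v
    ... | yes e = e
    ... | no ¬e = contradiction (subst (1 ≤_) (offEdge u v ¬e) pos) λ ()

    into outof : Cell → ℕ
    into  c = ∑ R (λ d → f (cell d) (cell c))
    outof c = ∑ R (λ d → f (cell c) (cell d))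

    inflow≡ : ∀ c → inflow R f (cell c) ≡ f src (cell c) + (f snk (cell c) + into c)
    inflow≡ c = ∑-vertices (λ u → f u (cell c))

    outflow-to-cells : ∀ {c} → ¬ InW R P c → outflow R f (cell c) ≡ outof c
    outflow-to-cells {c} c∉W = trans (∑-vertices (f (cell c)))
      (cong₂ (λ a b → a + (b + outof c)) (offEdge _ _ λ ()) (offEdge _ _ λ { (w→t c∈W) → c∉W c∈W }))

    into≤1 : ∀ {c} → c ∈ R → into c ≤ 1
    into≤1 {c} c∈R = begin
      into c                                        ≤⟨ m≤n+m (into c) (f snk (cell c)) ⟩
      f snk (cell c) + into c                       ≤⟨ m≤n+m _ (f src (cell c)) ⟩
      f src (cell c) + (f snk (cell c) + into c)    ≡⟨ sym (inflow≡ c) ⟩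
      inflow R f (cell c)                           ≤⟨ vertexCap c∈R ⟩
      1                                             ∎
      where open ≤-Reasoning

    outof≤1 : ∀ {b} → InB R P b → outof b ≤ 1
    outof≤1 {b} (b∈R , _ , black) = begin
      outof b              ≡⟨ sym (outflow-to-cells (λ (_ , _ , white) → white black)) ⟩
      outflow R f (cell b) ≡⟨ sym (conservation b∈R) ⟩
      inflow R f (cell b)  ≤⟨ vertexCap b∈R ⟩
      1                    ∎
      where open ≤-Reasoning

    module Bound (uR : Unique R) (uP : Unique P) (P⊆R : P ⊆ R) where

      pegInflow : Cell → ℕ
      pegInflow u = 𝟙 (u ∈? P) * into u

      source-to-pegs : ∀ {c} → c ∈ R → f src (cell c) ≤ ∑ R (λ u → 𝟙 (u ∈? P) * f (cell c) (cell u))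
      source-to-pegs {c} c∈R with edge? src (cell c)
      ... | no ¬e = subst (_≤ ∑ R (λ u → 𝟙 (u ∈? P) * f (cell c) (cell u))) (sym (offEdge src (cell c) ¬e)) z≤n
      ... | yes (s→b (_ , c∉P , black)) = begin
        f src (cell c)       ≤⟨ ∑-member (λ u → f u (cell c)) {vertices R} (here refl) ⟩
        inflow R f (cell c)  ≡⟨ conservation c∈R ⟩
        outflow R f (cell c) ≡⟨ outflow-to-cells (λ (_ , _ , white) → white black) ⟩
        outof c              ≡⟨ ∑-cong R (λ {u} _ → only-pegs u (u ∈? P)) ⟩
        ∑ R (λ u → 𝟙 (u ∈? P) * f (cell c) (cell u)) ∎
        where
        open ≤-Reasoning
        only-pegs : ∀ u (u∈?P : Dec (u ∈ P)) → f (cell c) (cell u) ≡ 𝟙 u∈?P * f (cell c) (cell u)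
        only-pegs u (yes _)   = sym (+-identityʳ _)
        only-pegs u (no  u∉P) = offEdge _ _ λ { (b→p _ u∈P _) → u∉P u∈P ; (p→w c∈P _ _) → c∉P c∈P }

      value≤pegInflow : value R f ≤ ∑ R pegInflow
      value≤pegInflow = begin
        value R f                                                ≡⟨ value≡ ⟩
        ∑ R (λ c → f src (cell c))                               ≤⟨ ∑-mono R source-to-pegs ⟩
        ∑ R (λ c → ∑ R (λ u → 𝟙 (u ∈? P) * f (cell c) (cell u))) ≡⟨ ∑-swap _ R R ⟩
        ∑ R (λ u → ∑ R (λ c → 𝟙 (u ∈? P) * f (cell c) (cell u))) ≡⟨ ∑-cong R (λ {u} _ → ∑-*ˡ (𝟙 (u ∈? P)) _ R) ⟩
        ∑ R pegInflow                                            ∎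
        where
        open ≤-Reasoning
        value≡ : value R f ≡ ∑ R (λ c → f src (cell c))
        value≡ = trans (∑-vertices (f src)) (cong₂ (λ a b → a + (b + ∑ R (λ c → f src (cell c)))) (offEdge src src λ ()) (offEdge src snk λ ()))

      pegInflow≤1 : ∀ {u} → u ∈ R → pegInflow u ≤ 𝟙 (u ∈? P)
      pegInflow≤1 {u} u∈R = ≤-trans (*-monoʳ-≤ (𝟙 (u ∈? P)) (into≤1 u∈R)) (≤-reflexive (*-identityʳ _))

      value≤pegs : value R f ≤ length P
      value≤pegs = ≤-trans value≤pegInflow (≤-trans (∑-mono R pegInflow≤1) (≤-reflexive (∑-𝟙-∈ uR uP P⊆R)))

      module Saturated (value≡|P| : value R f ≡ length P) where

        -- The bound ∑ pegInflow ≤ |P| is attained, so each peg gets its unit.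
        peg-fed : ∀ {p} → p ∈ P → 1 ≤ into p
        peg-fed {p} p∈P =
          ≤-trans (subst (λ k → k ≤ k * into p) (𝟙-yes (p ∈? P) p∈P) tight) (≤-reflexive (*-identityˡ (into p)))
          where
          tight : 𝟙 (p ∈? P) ≤ pegInflow p
          tight = ∑-tight pegInflow (λ u → 𝟙 (u ∈? P)) R pegInflow≤1
            (≤-trans (≤-reflexive (trans (∑-𝟙-∈ uR uP P⊆R) (sym value≡|P|))) value≤pegInflow) (P⊆R p∈P)

        peg-drained : ∀ {p} → p ∈ P → 1 ≤ outof p
        peg-drained {p} p∈P = begin
          1                                           ≤⟨ peg-fed p∈P ⟩
          into p                                      ≤⟨ m≤n+m (into p) (f snk (cell p)) ⟩
          f snk (cell p) + into p                     ≤⟨ m≤n+m _ (f src (cell p)) ⟩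
          f src (cell p) + (f snk (cell p) + into p)  ≡⟨ sym (inflow≡ p) ⟩
          inflow R f (cell p)                         ≡⟨ conservation (P⊆R p∈P) ⟩
          outflow R f (cell p)                        ≡⟨ outflow-to-cells (λ (_ , p∉P , _) → p∉P p∈P) ⟩
          outof p                                     ∎
          where open ≤-Reasoning

module FromSaturatedFlow {R P : List Cell} (uR : Unique R) (uP : Unique P) (P⊆R : P ⊆ R)
  {f} (F : IsFlow R P f) (value≡|P| : value R f ≡ length P) where

  open Network R P
  open Flow F
  open Bound uR uP P⊆R
  open Saturated value≡|P|

  record Passage (p : Cell) : Set where
    field
      b w    : Cell
      b∈B    : InB R P b
      w∈W    : InW R P w
      b-adj  : Adjacent b p
      w-adj  : Adjacent p w
      b→p>0 : 1 ≤ f (cell b) (cell p)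
      p→w>0 : 1 ≤ f (cell p) (cell w)

  -- The cells feeding and draining p are found by the saturation lemmas, and
  -- the edges carrying flow into and out of p tell their colours.
  passage : ∀ {p} → p ∈ P → Passage p
  passage {p} p∈P
    with ∑-pos (λ d → f (cell d) (cell p)) R (peg-fed p∈P) | ∑-pos (f (cell p) ∘ cell) R (peg-drained p∈P)
  ... | b , _ , in>0 | w , _ , out>0 with positive-edge in>0 | positive-edge out>0
  ... | b→p b∈B _ b-adj          | p→w _ w∈W w-adj = record
    { b = b ; w = w ; b∈B = b∈B ; w∈W = w∈W ; b-adj = b-adj ; w-adj = w-adj ; b→p>0 = in>0 ; p→w>0 = out>0 }
  ... | p→w _ (_ , p∉P , _) _    | _               = ⊥-elim (p∉P p∈P)
  ... | _                        | b→p (_ , p∉P , _) _ _ = ⊥-elim (p∉P p∈P)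

  Carrier : Cell → Tromino → Set
  Carrier p t = p ∈ P × Tromino.corner t ≡ p × Σ (Passage p) λ π → Tips t (Passage.b π) (Passage.w π)

  carrier : ∀ {p} → p ∈ P → Σ Tromino (Carrier p)
  carrier {p} p∈P =
    let (t , corner≡p , tips) = tromino-at (proj₂ (proj₂ b∈B)) (proj₂ (proj₂ w∈W)) (adjacent-sym {b} {p} b-adj) w-adj
    in t , p∈P , corner≡p , π , tips
    where
    π : Passage p
    π = passage p∈P
    open Passage π

  data Role (p c : Cell) : Set where
    peg   : c ≡ p → c ∈ P → Role p c
    feed  : InB R P c → 1 ≤ f (cell c) (cell p) → Role p c
    drain : InW R P c → 1 ≤ f (cell p) (cell c) → Role p c

  role : ∀ {p t c} → Carrier p t → c ∈ cellsOf t → Role p c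
  role (p∈P , refl , π , tips) c∈t with cell-of-tromino tips c∈t
  ... | inj₁ refl        = peg refl p∈P
  ... | inj₂ (inj₁ refl) = feed (Passage.b∈B π) (Passage.b→p>0 π)
  ... | inj₂ (inj₂ refl) = drain (Passage.w∈W π) (Passage.p→w>0 π)

  role-in-R : ∀ {p c} → Role p c → c ∈ R
  role-in-R (peg _ c∈P)         = P⊆R c∈P
  role-in-R (feed (c∈R , _) _)  = c∈R
  role-in-R (drain (c∈R , _) _) = c∈R

  -- No cell plays a part for two distinct pegs: capacities forbid a cell to
  -- feed or drain two pegs, and the other roles are told apart by P and colour.
  two≰one : ¬ 2 ≤ 1
  two≰one (s≤s ())

  roles-exclusive : ∀ {p q c} → p ∈ P → q ∈ P → p ≢ q → Role p c → Role q c → ⊥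
  roles-exclusive _ _ p≢q (peg refl _)              (peg refl _)              = p≢q refl
  roles-exclusive _ _ _   (peg _ c∈P)               (feed (_ , c∉P , _) _)    = c∉P c∈P
  roles-exclusive _ _ _   (peg _ c∈P)               (drain (_ , c∉P , _) _)   = c∉P c∈P
  roles-exclusive _ _ _   (feed (_ , c∉P , _) _)    (peg _ c∈P)               = c∉P c∈P
  roles-exclusive _ _ _   (drain (_ , c∉P , _) _)   (peg _ c∈P)               = c∉P c∈P
  roles-exclusive _ _ _   (feed (_ , _ , black) _)  (drain (_ , _ , white) _) = white black
  roles-exclusive _ _ _   (drain (_ , _ , white) _) (feed (_ , _ , black) _)  = white black
  roles-exclusive {p} {q} {c} p∈P q∈P p≢q (feed c∈B c→p) (feed _ c→q) = two≰one (begin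
    2                                 ≤⟨ +-mono-≤ c→p c→q ⟩
    f (cell c) (cell p) + f (cell c) (cell q) ≤⟨ ∑-pair (f (cell c) ∘ cell) (P⊆R p∈P) (P⊆R q∈P) p≢q ⟩
    outof c                           ≤⟨ outof≤1 c∈B ⟩
    1                                 ∎)
    where open ≤-Reasoning
  roles-exclusive {p} {q} {c} p∈P q∈P p≢q (drain (c∈R , _) p→c) (drain _ q→c) = two≰one (begin
    2                                 ≤⟨ +-mono-≤ p→c q→c ⟩
    f (cell p) (cell c) + f (cell q) (cell c) ≤⟨ ∑-pair (λ d → f (cell d) (cell c)) (P⊆R p∈P) (P⊆R q∈P) p≢q ⟩
    into c                            ≤⟨ into≤1 c∈R ⟩
    1                                 ∎)
    where open ≤-Reasoning

  carriers-disjoint : ∀ {p q t u} → p ≢ q → Carrier p t → Carrier q u → Apart t u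
  carriers-disjoint p≢q ct@(p∈P , _) cu@(q∈P , _) (c∈t , c∈u) = roles-exclusive p∈P q∈P p≢q (role ct c∈t) (role cu c∈u)

  carriers : Σ (List Tromino) λ T → length T ≡ length P
                                  × (∀ {t} → t ∈ T → Σ Cell λ p → p ∈ P × Carrier p t)
                                  × AllPairs Apart T
  carriers = choose {Q = Carrier} {_~_ = Apart} P uP carrier carriers-disjoint

  T : List Tromino
  T = proj₁ carriers

  carried : ∀ {t} → t ∈ T → Σ Cell λ p → p ∈ P × Carrier p t
  carried = proj₁ (proj₂ (proj₂ carriers))

  contained : ∀ {t} → t ∈ T → ∀ {c} → c ∈ cellsOf t → c ∈ R
  contained t∈T c∈t = role-in-R (role (proj₂ (proj₂ (carried t∈T))) c∈t)

  cornerPeg : ∀ {t} → t ∈ T → Tromino.corner t ∈ P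
  cornerPeg t∈T = let (_ , _ , p∈P , corner≡p , _) = carried t∈T in subst (_∈ P) (sym corner≡p) p∈P

  tipsFree : ∀ {t} → t ∈ T → htip t ∉ P × vtip t ∉ P
  tipsFree t∈T = let (_ , _ , _ , _ , π , tips) = carried t∈T in tips⁻ tips {_∉ P} (proj₁ (proj₂ (Passage.b∈B π))) (proj₁ (proj₂ (Passage.w∈W π)))

  -- The carriers form a p-cover: being as many as the pegs, they fill R.
  cover : 3 ∣ length R → length P ≡ length R / 3 → HasPCover R P
  cover 3∣|R| |P|≡|R|/3 = T , record
    { disjoint  = disjoint
    ; contained = contained
    ; cornerPeg = cornerPeg
    ; htipFree  = proj₁ ∘ tipsFree
    ; vtipFree  = proj₂ ∘ tipsFree
    ; covers    = Packing.covers uR disjoint distinct contained enough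
    }
    where
    disjoint : AllPairs Apart T
    disjoint = proj₂ (proj₂ (proj₂ carriers))
    distinct : ∀ {t} → t ∈ T → Unique (cellsOf t)
    distinct t∈T = tromino-distinct (cornerPeg t∈T) (proj₁ (tipsFree t∈T)) (proj₂ (tipsFree t∈T))
    enough : length R ≤ 3 * length T
    enough = ≤-reflexive (begin
      length R             ≡⟨ sym (m*[n/m]≡n 3∣|R|) ⟩
      3 * (length R / 3)   ≡⟨ cong (3 *_) (trans (sym |P|≡|R|/3) (sym (proj₁ (proj₂ carriers)))) ⟩
      3 * length T         ∎)
      where open ≡-Reasoning

pathFlow : Cell → Cell → Cell → Vertex → Vertex → ℕ
pathFlow b p w src      (cell c) = 𝟙 (c ≟ᶜ b)
pathFlow b p w (cell c) (cell d) = 𝟙 (c ≟ᶜ b) * 𝟙 (d ≟ᶜ p) + 𝟙 (c ≟ᶜ p) * 𝟙 (d ≟ᶜ w)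
pathFlow b p w (cell c) snk      = 𝟙 (c ≟ᶜ w)
pathFlow b p w _        _        = 0

visits : Cell → Cell → Cell → Cell → ℕ
visits b p w c = 𝟙 (c ≟ᶜ b) + 𝟙 (c ≟ᶜ p) + 𝟙 (c ≟ᶜ w)

𝟙*𝟙≡0 : ∀ {X Y : Set} (x : Dec X) (y : Dec Y) → ¬ (X × Y) → 𝟙 x * 𝟙 y ≡ 0
𝟙*𝟙≡0 (yes x) (yes y) ¬xy = ⊥-elim (¬xy (x , y))
𝟙*𝟙≡0 (yes _) (no _)  _   = refl
𝟙*𝟙≡0 (no _)  _       _   = refl

module Paths (R P : List Cell) (uR : Unique R) where

  open Network R P

  select : ∀ {x} → x ∈ R → ∀ k → ∑ R (λ d → 𝟙 (d ≟ᶜ x) * k) ≡ k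
  select {x} x∈R k = trans (∑-*ʳ k (λ d → 𝟙 (d ≟ᶜ x)) R) (trans (cong (_* k) (∑-𝟙-≟ uR x∈R)) (+-identityʳ k))

  select′ : ∀ {x} → x ∈ R → ∀ k → ∑ R (λ d → k * 𝟙 (d ≟ᶜ x)) ≡ k
  select′ {x} x∈R k = trans (∑-cong R (λ {d} _ → *-comm k (𝟙 (d ≟ᶜ x)))) (select x∈R k)

  module _ {b p w} (b∈R : b ∈ R) (p∈R : p ∈ R) (w∈R : w ∈ R) where

    path-in : ∀ c → inflow R (pathFlow b p w) (cell c) ≡ visits b p w c
    path-in c = begin
      inflow R (pathFlow b p w) (cell c)
        ≡⟨ ∑-vertices (λ u → pathFlow b p w u (cell c)) ⟩
      𝟙 (c ≟ᶜ b) + (0 + ∑ R (λ d → 𝟙 (d ≟ᶜ b) * 𝟙 (c ≟ᶜ p) + 𝟙 (d ≟ᶜ p) * 𝟙 (c ≟ᶜ w)))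
        ≡⟨ cong (𝟙 (c ≟ᶜ b) +_) (∑-+ _ _ R) ⟩
      𝟙 (c ≟ᶜ b) + (∑ R (λ d → 𝟙 (d ≟ᶜ b) * 𝟙 (c ≟ᶜ p)) + ∑ R (λ d → 𝟙 (d ≟ᶜ p) * 𝟙 (c ≟ᶜ w)))
        ≡⟨ cong (𝟙 (c ≟ᶜ b) +_) (cong₂ _+_ (select b∈R (𝟙 (c ≟ᶜ p))) (select p∈R (𝟙 (c ≟ᶜ w)))) ⟩
      𝟙 (c ≟ᶜ b) + (𝟙 (c ≟ᶜ p) + 𝟙 (c ≟ᶜ w))
        ≡⟨ sym (+-assoc (𝟙 (c ≟ᶜ b)) (𝟙 (c ≟ᶜ p)) (𝟙 (c ≟ᶜ w))) ⟩
      visits b p w c ∎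
      where open ≡-Reasoning

    path-out : ∀ c → outflow R (pathFlow b p w) (cell c) ≡ visits b p w c
    path-out c = begin
      outflow R (pathFlow b p w) (cell c)
        ≡⟨ ∑-vertices (pathFlow b p w (cell c)) ⟩
      0 + (𝟙 (c ≟ᶜ w) + ∑ R (λ d → 𝟙 (c ≟ᶜ b) * 𝟙 (d ≟ᶜ p) + 𝟙 (c ≟ᶜ p) * 𝟙 (d ≟ᶜ w)))
        ≡⟨ cong (𝟙 (c ≟ᶜ w) +_) (∑-+ _ _ R) ⟩
      𝟙 (c ≟ᶜ w) + (∑ R (λ d → 𝟙 (c ≟ᶜ b) * 𝟙 (d ≟ᶜ p)) + ∑ R (λ d → 𝟙 (c ≟ᶜ p) * 𝟙 (d ≟ᶜ w)))
        ≡⟨ cong (𝟙 (c ≟ᶜ w) +_) (cong₂ _+_ (select′ p∈R (𝟙 (c ≟ᶜ b))) (select′ w∈R (𝟙 (c ≟ᶜ p)))) ⟩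
      𝟙 (c ≟ᶜ w) + (𝟙 (c ≟ᶜ b) + 𝟙 (c ≟ᶜ p))
        ≡⟨ +-comm (𝟙 (c ≟ᶜ w)) (𝟙 (c ≟ᶜ b) + 𝟙 (c ≟ᶜ p)) ⟩
      visits b p w c ∎
      where open ≡-Reasoning

    path-value : value R (pathFlow b p w) ≡ 1
    path-value = trans (∑-vertices (pathFlow b p w src)) (∑-𝟙-≟ uR b∈R)

  path-offEdge : ∀ {b p w} → InB R P b → p ∈ P → InW R P w → Adjacent b p → Adjacent p w
               → ∀ u v → ¬ Edge R P u v → pathFlow b p w u v ≡ 0
  path-offEdge {b} b∈B p∈P w∈W b-adj w-adj src (cell c) ¬e =
    𝟙-no (c ≟ᶜ b) (λ { refl → ¬e (s→b b∈B) })
  path-offEdge {w = w} b∈B p∈P w∈W b-adj w-adj (cell c) snk ¬e =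
    𝟙-no (c ≟ᶜ w) (λ { refl → ¬e (w→t w∈W) })
  path-offEdge {b} {p} {w} b∈B p∈P w∈W b-adj w-adj (cell c) (cell d) ¬e = cong₂ _+_
    (𝟙*𝟙≡0 (c ≟ᶜ b) (d ≟ᶜ p) (λ { (refl , refl) → ¬e (b→p b∈B p∈P b-adj) }))
    (𝟙*𝟙≡0 (c ≟ᶜ p) (d ≟ᶜ w) (λ { (refl , refl) → ¬e (p→w p∈P w∈W w-adj) }))
  path-offEdge _ _ _ _ _ src      src      _ = refl
  path-offEdge _ _ _ _ _ src      snk      _ = refl
  path-offEdge _ _ _ _ _ snk      _        _ = refl
  path-offEdge _ _ _ _ _ (cell _) src      _ = refl

module FromPCover {R P : List Cell} (uR : Unique R) (P⊆R : P ⊆ R) {T : List Tromino} (C : PCover R P T) where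

  open PCover C
  open Network R P
  open Paths R P uR

  tips-inside : ∀ {t} → t ∈ T → blackTip t ∈ R × whiteTip t ∈ R
  tips-inside {t} t∈T =
    tips⁺ (tips-coloured t) {_∈ R} (contained t∈T (there (here refl))) (contained t∈T (there (there (here refl))))

  tips-free : ∀ {t} → t ∈ T → blackTip t ∉ P × whiteTip t ∉ P
  tips-free {t} t∈T = tips⁺ (tips-coloured t) {_∉ P} (htipFree t∈T) (vtipFree t∈T)

  distinct : ∀ {t} → t ∈ T → Unique (cellsOf t)
  distinct t∈T = tromino-distinct (cornerPeg t∈T) (htipFree t∈T) (vtipFree t∈T)

  visits≡occupies : ∀ {t} → t ∈ T → ∀ c → visits (blackTip t) (Tromino.corner t) (whiteTip t) c ≡ occupies t c
  visits≡occupies {t} t∈T c = begin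
    𝟙 (c ≟ᶜ b) + 𝟙 (c ≟ᶜ p) + 𝟙 (c ≟ᶜ w)   ≡⟨ swap-first (𝟙 (c ≟ᶜ b)) (𝟙 (c ≟ᶜ p)) (𝟙 (c ≟ᶜ w)) ⟩
    𝟙 (c ≟ᶜ p) + (𝟙 (c ≟ᶜ b) + 𝟙 (c ≟ᶜ w)) ≡⟨ cong (𝟙 (c ≟ᶜ p) +_) (tips-sum (tips-coloured t) (λ d → 𝟙 (c ≟ᶜ d))) ⟩
    𝟙 (c ≟ᶜ p) + (𝟙 (c ≟ᶜ htip t) + 𝟙 (c ≟ᶜ vtip t)) ≡⟨ sym (∑-cells c) ⟩
    ∑ (cellsOf t) (λ d → 𝟙 (c ≟ᶜ d))       ≡⟨ sym (𝟙-∈ c (distinct t∈T)) ⟩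
    occupies t c                           ∎
    where
    open ≡-Reasoning
    b p w : Cell
    b = blackTip t
    p = Tromino.corner t
    w = whiteTip t
    swap-first : ∀ x y z → x + y + z ≡ y + (x + z)
    swap-first x y z = trans (cong (_+ z) (+-comm x y)) (+-assoc y x z)
    ∑-cells : ∀ c → ∑ (cellsOf t) (λ d → 𝟙 (c ≟ᶜ d)) ≡ 𝟙 (c ≟ᶜ p) + (𝟙 (c ≟ᶜ htip t) + 𝟙 (c ≟ᶜ vtip t))
    ∑-cells c = cong (λ s → 𝟙 (c ≟ᶜ p) + (𝟙 (c ≟ᶜ htip t) + s)) (+-identityʳ (𝟙 (c ≟ᶜ vtip t)))

  pathOf : Tromino → Vertex → Vertex → ℕ
  pathOf t = pathFlow (blackTip t) (Tromino.corner t) (whiteTip t)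

  coverFlow : Vertex → Vertex → ℕ
  coverFlow u v = ∑ T (λ t → pathOf t u v)

  path-in-R : ∀ {t} → t ∈ T → blackTip t ∈ R × Tromino.corner t ∈ R × whiteTip t ∈ R
  path-in-R t∈T = proj₁ (tips-inside t∈T) , P⊆R (cornerPeg t∈T) , proj₂ (tips-inside t∈T)

  path-along-edges : ∀ {t} → t ∈ T → ∀ u v → ¬ Edge R P u v → pathOf t u v ≡ 0
  path-along-edges {t} t∈T =
    let (b∈R , w∈R)     = tips-inside t∈T
        (b∉P , w∉P)     = tips-free t∈T
        (b-adj , w-adj) = tips-adjacent (tips-coloured t)
    in path-offEdge (b∈R , b∉P , blackTip-black t) (cornerPeg t∈T) (w∈R , w∉P , whiteTip-white t) b-adj w-adj

  inflow≡ : ∀ c → inflow R coverFlow (cell c) ≡ ∑ T (λ t → occupies t c)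
  inflow≡ c = trans (∑-swap (λ u t → pathOf t u (cell c)) (vertices R) T)
    (∑-cong T (λ t∈T → let (b∈R , p∈R , w∈R) = path-in-R t∈T in
                        trans (path-in b∈R p∈R w∈R c) (visits≡occupies t∈T c)))

  outflow≡ : ∀ c → outflow R coverFlow (cell c) ≡ ∑ T (λ t → occupies t c)
  outflow≡ c = trans (∑-swap (λ v t → pathOf t (cell c) v) (vertices R) T)
    (∑-cong T (λ t∈T → let (b∈R , p∈R , w∈R) = path-in-R t∈T in
                        trans (path-out b∈R p∈R w∈R c) (visits≡occupies t∈T c)))

  value≡|T| : value R coverFlow ≡ length T
  value≡|T| = trans (∑-swap (λ v t → pathOf t src v) (vertices R) T)
    (trans (∑-cong T (λ t∈T → let (b∈R , p∈R , w∈R) = path-in-R t∈T in path-value b∈R p∈R w∈R)) (∑-length T))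

  -- Vertex capacities hold as the trominoes are disjoint; edge capacities follow.
  isFlow : IsFlow R P coverFlow
  isFlow = record
    { offEdge      = offEdge
    ; edgeCap      = edge-capacity P⊆R offEdge vertexCap conservation
    ; vertexCap    = vertexCap
    ; conservation = conservation
    }
    where
    offEdge : ∀ u v → ¬ Edge R P u v → coverFlow u v ≡ 0
    offEdge u v ¬e = ∑-zero T (λ t∈T → path-along-edges t∈T u v ¬e)
    vertexCap : ∀ {c} → c ∈ R → inflow R coverFlow (cell c) ≤ 1
    vertexCap {c} _ = ≤-trans (≤-reflexive (inflow≡ c)) (Packing.occupancy≤1 uR disjoint distinct contained c)
    conservation : ∀ {c} → c ∈ R → inflow R coverFlow (cell c) ≡ outflow R coverFlow (cell c)
    conservation {c} _ = trans (inflow≡ c) (sym (outflow≡ c))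

  |R|/3≡|T| : length R / 3 ≡ length T
  |R|/3≡|T| = trans (cong (_/ 3) (trans (Packing.size uR disjoint distinct contained covers) (*-comm 3 (length T))))
                    (m*n/n≡m (length T) 3)

proposition3p1 : (R P : List Cell) → IsRegion R → 3 ∣ length R
    → Unique P → P ⊆ R → length P ≡ length R / 3
    → IsMaxFlowValue R P (length R / 3) ⇔ HasPCover R P
proposition3p1 R P region 3∣|R| uP P⊆R |P|≡|R|/3 = mk⇔ cover-from-flow flow-from-cover
  where
  uR : Unique R
  uR = IsRegion.distinct region

  cover-from-flow : IsMaxFlowValue R P (length R / 3) → HasPCover R P
  cover-from-flow ((f , F , value≡|R|/3) , _) =
    FromSaturatedFlow.cover uR uP P⊆R F (trans value≡|R|/3 (sym |P|≡|R|/3)) 3∣|R| |P|≡|R|/3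

  -- A p-cover yields a flow of value |R|/3, which is maximum since no flow exceeds |P|.
  flow-from-cover : HasPCover R P → IsMaxFlowValue R P (length R / 3)
  flow-from-cover (T , C) = (coverFlow , isFlow , trans value≡|T| (sym |R|/3≡|T|)) , bounded
    where
    open FromPCover uR P⊆R C
    bounded : ∀ g → IsFlow R P g → value R g ≤ length R / 3
    bounded g G = subst (value R g ≤_) |P|≡|R|/3 (Network.Flow.Bound.value≤pegs R P G uR uP P⊆R)
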